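{- Let $n$ be an even positive integer and let $m$ be the integer with $2^m<n\leq 2^{m+1}$. Suppose $n$ is not expressible as a sum of two powers of $2$, and $n$ is not of any of the forms (a) $2^{m_1}+2^{m_2}+2^{m_3}$ with $m=m_1>m_2>m_3\geq 1$; (b) $2^{m_1}+2^{m_2}+2^{m_3}+2^{m_4}$ with $m=m_1>m_2>m_3>m_4\geq 2$ and $m_1+m_4=m_2+m_3$; (c) $2^{m_1}+2^{m_1-3}+2^{m_2}+2^{m_2-1}$ with $m=m_1\geq m_2+3\geq 6$; (d) $2^m+2^{m-5}+2^{m-6}+2^{m-7}$ with $m\geq 10$. Then $\log_2 n+2\leq\|n\|_2$. In particular, if $n$ is a sum of at least five distinct powers of $2$, then $\log_2 n+2\leq\|n\|_2$.
   Context: For an even positive integer $n$, the $2$-complexity $\|n\|_2$ is the minimal number of copies of $2$ needed to express $n$ from $2$ using only addition and multiplication (and parentheses). Equivalently, $\|2\|_2=1$ and $\|n\|_2=\min(\|a\|_2+\|b\|_2)$, the minimum over even positive $a,b$ with $a+b=n$ or $ab=n$. -}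

module Defs where

open import Data.Nat using (ℕ; _+_; _*_; _^_; _≤_; _<_; _≥_; _>_; _∸_)
open import Data.Nat.Divisibility using (_∣_)
open import Data.Product using (_×_; ∃-syntax)
open import Data.List using (List; length; map)
open import Data.Nat.ListAction using (sum)
open import Data.List.Relation.Unary.Unique.Propositional using (Unique)
open import Relation.Binary.PropositionalEquality using (_≡_)
open import Relation.Nullary using (¬_)

data Expr : Set where
  two : Expr
  _⊕_ : Expr → Expr → Expr
  _⊗_ : Expr → Expr → Expr

eval : Expr → ℕ
eval two = 2
eval (e ⊕ f) = eval e + eval f
eval (e ⊗ f) = eval e * eval f

copies : Expr → ℕ
copies two = 1
copies (e ⊕ f) = copies e + copies f
copies (e ⊗ f) = copies e + copies f

-- ‖ n ‖₂ ≡ k : k is the minimal number of copies of 2 needed to express n.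
record Complexity₂ (n k : ℕ) : Set where
  field
    witness : ∃[ e ] (eval e ≡ n × copies e ≡ k)
    minimal : ∀ e → eval e ≡ n → k ≤ copies e

SumOfTwoPowers : ℕ → Set
SumOfTwoPowers n = ∃[ a ] ∃[ b ] (n ≡ 2 ^ a + 2 ^ b)

FormA : ℕ → ℕ → Set
FormA m n = ∃[ m₂ ] ∃[ m₃ ]
  (m > m₂ × m₂ > m₃ × m₃ ≥ 1 × n ≡ 2 ^ m + 2 ^ m₂ + 2 ^ m₃)

FormB : ℕ → ℕ → Set
FormB m n = ∃[ m₂ ] ∃[ m₃ ] ∃[ m₄ ]
  (m > m₂ × m₂ > m₃ × m₃ > m₄ × m₄ ≥ 2 × m + m₄ ≡ m₂ + m₃ ×
   n ≡ 2 ^ m + 2 ^ m₂ + 2 ^ m₃ + 2 ^ m₄)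

FormC : ℕ → ℕ → Set
FormC m n = ∃[ m₂ ]
  (m ≥ m₂ + 3 × m₂ + 3 ≥ 6 ×
   n ≡ 2 ^ m + 2 ^ (m ∸ 3) + 2 ^ m₂ + 2 ^ (m₂ ∸ 1))

FormD : ℕ → ℕ → Set
FormD m n = m ≥ 10 × n ≡ 2 ^ m + 2 ^ (m ∸ 5) + 2 ^ (m ∸ 6) + 2 ^ (m ∸ 7)

SumOfAtLeastFiveDistinctPowers : ℕ → Set
SumOfAtLeastFiveDistinctPowers n = ∃[ es ]
  (Unique es × 5 ≤ length es × sum (map (2 ^_) es) ≡ n)

-- Every expression with k copies of 2 and value n has a Shape: n = 2^x with x ≤ k;
-- n = 2^x (2^p + 1) with x + p + 1 ≤ k; n in one of four exceptional families with
-- ⌊log₂ n⌋ + 2 ≤ k; or the generic case 4 n ≤ 2^k. A sum or product of operands whose copy count exceeds ⌊log₂⌋ by enough is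
-- generic (Excess); otherwise the sum or product of the explicit forms is computed, using
-- (2^p + 1)(2^q + 1)(2^s + 1) ≤ 2^(p+q+s+1) outside the triples listed in SmallTriple.
-- The exceptional families are the forms (a)–(d) once m is identified with ⌊log₂ n⌋, and
-- no non-generic shape has more than four binary digits.

module Submission where

open import Defs
open import Data.Nat using (ℕ; _+_; _*_; _^_; _≤_; _<_)
open import Data.Nat.Divisibility using (_∣_)
open import Data.Product using (_×_)
open import Relation.Nullary using (¬_)

open import Data.Bool.Base using (T)
open import Data.Empty using (⊥-elim)
open import Data.List using (List; []; _∷_; length; map)
open import Data.List.Relation.Unary.All using (All; []; _∷_)
open import Data.List.Relation.Unary.AllPairs using ([]; _∷_)
open import Data.List.Relation.Unary.Unique.Propositional using (Unique)
open import Data.Nat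
open import Data.Nat.Induction using (<-wellFounded)
open import Data.Nat.ListAction using (sum)
open import Data.Nat.Properties
open import Data.Nat.Tactic.RingSolver using (solve-∀)
open import Data.Product using (_,_; ∃-syntax)
open import Data.Sum using (_⊎_; inj₁; inj₂; [_,_])
open import Induction.WellFounded using (Acc; acc)
open import Relation.Binary.Definitions using (tri<; tri≈; tri>)
open import Relation.Binary.PropositionalEquality hiding ([_])
open import Relation.Nullary using (yes; no)

≤-offset : ∀ {m n} → m ≤ n → ∃[ d ] n ≡ m + d
≤-offset m≤n = _ , sym (m+[n∸m]≡n m≤n)

<-offset : ∀ {m n} → m < n → ∃[ d ] n ≡ m + suc d
<-offset {m} m<n with ≤-offset m<n
... | d , refl = d , sym (+-suc m d)

≤-witness : ∀ {m n} d → m + d ≡ n → m ≤ n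
≤-witness {m} d refl = m≤m+n m d

≤-computed : ∀ {m n} {_ : T (m ≤ᵇ n)} → m ≤ n
≤-computed {m} {n} {m≤ᵇn} = ≤ᵇ⇒≤ m n m≤ᵇn

m+n≤m*n : ∀ {m n} → 2 ≤ m → 2 ≤ n → m + n ≤ m * n
m+n≤m*n m≥2 n≥2 with ≤-offset m≥2 | ≤-offset n≥2
... | a , refl | b , refl = ≤-witness (a + b + a * b) (expand a b)
  where
  expand : ∀ a b → 2 + a + (2 + b) + (a + b + a * b) ≡ (2 + a) * (2 + b)
  expand = solve-∀

2*[m+n]≤m*n : ∀ {m n} → 4 ≤ m → 4 ≤ n → 2 * (m + n) ≤ m * n
2*[m+n]≤m*n m≥4 n≥4 with ≤-offset m≥4 | ≤-offset n≥4
... | a , refl | b , refl = ≤-witness (2 * a + 2 * b + a * b) (expand a b)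
  where
  expand : ∀ a b → 2 * (4 + a + (4 + b)) + (2 * a + 2 * b + a * b) ≡ (4 + a) * (4 + b)
  expand = solve-∀

m+4*n≤m*n : ∀ {m n} → 8 ≤ m → 2 ≤ n → m + 4 * n ≤ m * n
m+4*n≤m*n m≥8 n≥2 with ≤-offset m≥8 | ≤-offset n≥2
... | a , refl | b , refl = ≤-witness (a + 4 * b + a * b) (expand a b)
  where
  expand : ∀ a b → 8 + a + 4 * (2 + b) + (a + 4 * b + a * b) ≡ (8 + a) * (2 + b)
  expand = solve-∀

m+n+2≤m*n : ∀ {m n} → 4 ≤ m → 2 ≤ n → m + n + 2 ≤ m * n
m+n+2≤m*n m≥4 n≥2 with ≤-offset m≥4 | ≤-offset n≥2
... | a , refl | b , refl = ≤-witness (a + 3 * b + a * b) (expand a b)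
  where
  expand : ∀ a b → 4 + a + (2 + b) + 2 + (a + 3 * b + a * b) ≡ (4 + a) * (2 + b)
  expand = solve-∀

m+2*n≤m*n+2 : ∀ {m n} → 2 ≤ m → 1 ≤ n → m + 2 * n ≤ m * n + 2
m+2*n≤m*n+2 m≥2 n≥1 with ≤-offset m≥2 | ≤-offset n≥1
... | a , refl | b , refl = ≤-witness (a * b) (expand a b)
  where
  expand : ∀ a b → 2 + a + 2 * (1 + b) + a * b ≡ (2 + a) * (1 + b) + 2
  expand = solve-∀

eval≥2 : ∀ e → 2 ≤ eval e
eval≥2 two = ≤-refl
eval≥2 (e ⊕ f) = ≤-trans (eval≥2 e) (m≤m+n _ _)
eval≥2 (e ⊗ f) = ≤-trans (eval≥2 e) (m≤m*n (eval e) (eval f) {{>-nonZero (m<n⇒0<n (eval≥2 f))}})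

eval≤2^copies : ∀ e → eval e ≤ 2 ^ copies e
eval≤2^copies two = ≤-refl
eval≤2^copies (e ⊕ f) = begin
  eval e + eval f              ≤⟨ +-mono-≤ (eval≤2^copies e) (eval≤2^copies f) ⟩
  2 ^ copies e + 2 ^ copies f  ≤⟨ m+n≤m*n (2≤2^copies e) (2≤2^copies f) ⟩
  2 ^ copies e * 2 ^ copies f  ≡⟨ ^-distribˡ-+-* 2 (copies e) (copies f) ⟨
  2 ^ (copies e + copies f)    ∎
  where
  open ≤-Reasoning
  2≤2^copies : ∀ e → 2 ≤ 2 ^ copies e
  2≤2^copies e = ≤-trans (eval≥2 e) (eval≤2^copies e)
eval≤2^copies (e ⊗ f) = begin
  eval e * eval f              ≤⟨ *-mono-≤ (eval≤2^copies e) (eval≤2^copies f) ⟩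
  2 ^ copies e * 2 ^ copies f  ≡⟨ ^-distribˡ-+-* 2 (copies e) (copies f) ⟨
  2 ^ (copies e + copies f)    ∎
  where open ≤-Reasoning

2^-double : ∀ m → 2 ^ m + 2 ^ m ≡ 2 ^ suc m
2^-double m = cong (2 ^ m +_) (sym (+-identityʳ (2 ^ m)))

2^[m+n]+2^m : ∀ m n → 2 ^ (m + n) + 2 ^ m ≡ 2 ^ m * (2 ^ n + 1)
2^[m+n]+2^m m n = begin
  2 ^ (m + n) + 2 ^ m      ≡⟨ cong (_+ 2 ^ m) (^-distribˡ-+-* 2 m n) ⟩
  2 ^ m * 2 ^ n + 2 ^ m    ≡⟨ cong (2 ^ m * 2 ^ n +_) (*-identityʳ (2 ^ m)) ⟨
  2 ^ m * 2 ^ n + 2 ^ m * 1 ≡⟨ *-distribˡ-+ (2 ^ m) (2 ^ n) 1 ⟨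
  2 ^ m * (2 ^ n + 1)      ∎
  where open ≡-Reasoning

2^-distrib₃ : ∀ a b c → 2 ^ (a + (b + c)) ≡ 2 ^ a * (2 ^ b * 2 ^ c)
2^-distrib₃ a b c = trans (^-distribˡ-+-* 2 a (b + c)) (cong (2 ^ a *_) (^-distribˡ-+-* 2 b c))

-- Odd parts 2^p + 2^q + 1, (2^p + 1)(2^q + 1), 9·2^u + 3 = 2^(u+3) + 2^u + 2 + 1 and
-- 135 = 2^7 + 2^2 + 2 + 1 give the forms (a), (b) (or (a) when p = q), (c) and (d).
data Exceptional (n k : ℕ) : Set where
  formA : ∀ x p q → 1 ≤ x → 1 ≤ q → q < p →
          n ≡ 2 ^ x * (2 ^ p + 2 ^ q + 1) → x + (p + 2) ≤ k → Exceptional n k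
  formB : ∀ x p q → 2 ≤ x → 1 ≤ p → 1 ≤ q → 3 ≤ p + q →
          n ≡ 2 ^ x * ((2 ^ p + 1) * (2 ^ q + 1)) → x + (p + q + 2) ≤ k → Exceptional n k
  formC : ∀ x u → 2 ≤ x → 1 ≤ u →
          n ≡ 2 ^ x * (9 * 2 ^ u + 3) → x + (u + 3 + 2) ≤ k → Exceptional n k
  formD : ∀ x → 3 ≤ x → n ≡ 2 ^ x * 135 → x + (7 + 2) ≤ k → Exceptional n k

data Shape (n k : ℕ) : Set where
  power       : ∀ x → 1 ≤ x → n ≡ 2 ^ x → x ≤ k → Shape n k
  twoPowers   : ∀ x p → 1 ≤ x → 1 ≤ p → n ≡ 2 ^ x * (2 ^ p + 1) → x + (p + 1) ≤ k → Shape n k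
  exceptional : Exceptional n k → Shape n k
  generic     : 4 * n ≤ 2 ^ k → Shape n k

+-shape-comm : ∀ {a b ka kb} → Shape (b + a) (kb + ka) → Shape (a + b) (ka + kb)
+-shape-comm {a} {b} {ka} {kb} = subst₂ Shape (+-comm b a) (+-comm kb ka)

*-shape-comm : ∀ {a b ka kb} → Shape (b * a) (kb + ka) → Shape (a * b) (ka + kb)
*-shape-comm {a} {b} {ka} {kb} = subst₂ Shape (*-comm b a) (+-comm kb ka)

weaken-exceptional : ∀ {n k k′} → k ≤ k′ → Exceptional n k → Exceptional n k′
weaken-exceptional k≤k′ (formA x p q x≥1 q≥1 q<p eq b) =
  formA x p q x≥1 q≥1 q<p eq (≤-trans b k≤k′)
weaken-exceptional k≤k′ (formB x p q x≥2 p≥1 q≥1 p+q≥3 eq b) =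
  formB x p q x≥2 p≥1 q≥1 p+q≥3 eq (≤-trans b k≤k′)
weaken-exceptional k≤k′ (formC x u x≥2 u≥1 eq b) = formC x u x≥2 u≥1 eq (≤-trans b k≤k′)
weaken-exceptional k≤k′ (formD x x≥3 eq b) = formD x x≥3 eq (≤-trans b k≤k′)

weaken : ∀ {n k k′} → k ≤ k′ → Shape n k → Shape n k′
weaken k≤k′ (power x x≥1 eq b) = power x x≥1 eq (≤-trans b k≤k′)
weaken k≤k′ (twoPowers x p x≥1 p≥1 eq b) = twoPowers x p x≥1 p≥1 eq (≤-trans b k≤k′)
weaken k≤k′ (exceptional e) = exceptional (weaken-exceptional k≤k′ e)
weaken k≤k′ (generic b) = generic (≤-trans b (^-monoʳ-≤ 2 k≤k′))

2^*-shift : ∀ z {n y} o → n ≡ 2 ^ y * o → 2 ^ z * n ≡ 2 ^ (z + y) * o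
2^*-shift z {y = y} o refl = begin
  2 ^ z * (2 ^ y * o) ≡⟨ *-assoc (2 ^ z) (2 ^ y) o ⟨
  2 ^ z * 2 ^ y * o   ≡⟨ cong (_* o) (^-distribˡ-+-* 2 z y) ⟨
  2 ^ (z + y) * o     ∎
  where open ≡-Reasoning

+-shift-≤ : ∀ z {y t k} → y + t ≤ k → z + y + t ≤ z + k
+-shift-≤ z {y} {t} b = ≤-trans (≤-reflexive (+-assoc z y t)) (+-monoʳ-≤ z b)

shift-exceptional : ∀ z {n k} → Exceptional n k → Exceptional (2 ^ z * n) (z + k)
shift-exceptional z (formA x p q x≥1 q≥1 q<p eq b) =
  formA (z + x) p q (m≤n⇒m≤o+n z x≥1) q≥1 q<p (2^*-shift z _ eq) (+-shift-≤ z b)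
shift-exceptional z (formB x p q x≥2 p≥1 q≥1 p+q≥3 eq b) =
  formB (z + x) p q (m≤n⇒m≤o+n z x≥2) p≥1 q≥1 p+q≥3 (2^*-shift z _ eq) (+-shift-≤ z b)
shift-exceptional z (formC x u x≥2 u≥1 eq b) =
  formC (z + x) u (m≤n⇒m≤o+n z x≥2) u≥1 (2^*-shift z _ eq) (+-shift-≤ z b)
shift-exceptional z (formD x x≥3 eq b) =
  formD (z + x) (m≤n⇒m≤o+n z x≥3) (2^*-shift z _ eq) (+-shift-≤ z b)

shift : ∀ z {n k} → Shape n k → Shape (2 ^ z * n) (z + k)
shift z (power x x≥1 refl b) =
  power (z + x) (m≤n⇒m≤o+n z x≥1) (sym (^-distribˡ-+-* 2 z x)) (+-monoʳ-≤ z b)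
shift z (twoPowers x p x≥1 p≥1 eq b) =
  twoPowers (z + x) p (m≤n⇒m≤o+n z x≥1) p≥1 (2^*-shift z _ eq) (+-shift-≤ z b)
shift z (exceptional e) = exceptional (shift-exceptional z e)
shift z {n} {k} (generic b) = generic (begin
  4 * (2 ^ z * n) ≡⟨ *-comm-middle 4 (2 ^ z) n ⟩
  2 ^ z * (4 * n) ≤⟨ *-monoʳ-≤ (2 ^ z) b ⟩
  2 ^ z * 2 ^ k   ≡⟨ ^-distribˡ-+-* 2 z k ⟨
  2 ^ (z + k)     ∎)
  where
  open ≤-Reasoning
  *-comm-middle : ∀ a b c → a * (b * c) ≡ b * (a * c)
  *-comm-middle = solve-∀

OddLog : ℕ → ℕ → Set
OddLog t o = 2 ^ t < o × o + 1 ≤ 2 ^ suc t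

-- k ≥ ⌊log₂ n⌋ + c; upper has room 2 since n is even and not a power of 2.
record Excess (c n k : ℕ) : Set where
  field
    log    : ℕ
    2≤log  : 2 ≤ log
    lower  : 2 ^ log < n
    upper  : n + 2 ≤ 2 ^ suc log
    budget : c + log ≤ k

excess : ∀ {c n k} x t {o} → 1 ≤ x → 2 ≤ x + t → n ≡ 2 ^ x * o → OddLog t o →
         x + (t + c) ≤ k → Excess c n k
excess {c} {n} {k} x t {o} x≥1 2≤x+t n≡ (t<o , o<) b = record
  { log = x + t ; 2≤log = 2≤x+t ; lower = lower ; upper = upper ; budget = budget }
  where
  open ≤-Reasoning
  lower : 2 ^ (x + t) < n
  lower = begin-strict
    2 ^ (x + t)   ≡⟨ ^-distribˡ-+-* 2 x t ⟩
    2 ^ x * 2 ^ t <⟨ *-monoʳ-< (2 ^ x) {{m^n≢0 2 x}} t<o ⟩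
    2 ^ x * o     ≡⟨ n≡ ⟨
    n             ∎
  upper : n + 2 ≤ 2 ^ suc (x + t)
  upper = begin
    n + 2               ≡⟨ cong (_+ 2) n≡ ⟩
    2 ^ x * o + 2       ≤⟨ +-monoʳ-≤ (2 ^ x * o) (^-monoʳ-≤ 2 x≥1) ⟩
    2 ^ x * o + 2 ^ x   ≡⟨ cong (2 ^ x * o +_) (*-identityʳ (2 ^ x)) ⟨
    2 ^ x * o + 2 ^ x * 1 ≡⟨ *-distribˡ-+ (2 ^ x) o 1 ⟨
    2 ^ x * (o + 1)     ≤⟨ *-monoʳ-≤ (2 ^ x) o< ⟩
    2 ^ x * 2 ^ suc t   ≡⟨ ^-distribˡ-+-* 2 x (suc t) ⟨
    2 ^ (x + suc t)     ≡⟨ cong (2 ^_) (+-suc x t) ⟩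
    2 ^ suc (x + t)     ∎
  budget : c + (x + t) ≤ k
  budget = ≤-trans (≤-reflexive (trans (+-comm c (x + t)) (+-assoc x t c))) b

excess-2⇒1 : ∀ {n k} → Excess 2 n k → Excess 1 n k
excess-2⇒1 e = record { Excess e; budget = ≤-trans (n≤1+n _) (Excess.budget e) }

oddLog-twoPowers : ∀ {p} → 1 ≤ p → OddLog p (2 ^ p + 1)
oddLog-twoPowers {p} p≥1 = m<m+n (2 ^ p) z<s , (begin
  2 ^ p + 1 + 1 ≡⟨ +-assoc (2 ^ p) 1 1 ⟩
  2 ^ p + 2     ≤⟨ +-monoʳ-≤ (2 ^ p) (^-monoʳ-≤ 2 p≥1) ⟩
  2 ^ p + 2 ^ p ≡⟨ 2^-double p ⟩
  2 ^ suc p     ∎)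
  where open ≤-Reasoning

oddLog-formA : ∀ {p q} → 1 ≤ q → q < p → OddLog p (2 ^ p + 2 ^ q + 1)
oddLog-formA {p} {q} q≥1 q<p = ≤-<-trans (m≤m+n (2 ^ p) (2 ^ q)) (m<m+n _ z<s) , (begin
  2 ^ p + 2 ^ q + 1 + 1     ≡⟨ reassoc (2 ^ p) (2 ^ q) ⟩
  2 ^ p + (2 ^ q + 2)       ≤⟨ +-monoʳ-≤ (2 ^ p) (+-monoʳ-≤ (2 ^ q) (^-monoʳ-≤ 2 q≥1)) ⟩
  2 ^ p + (2 ^ q + 2 ^ q)   ≡⟨ cong (2 ^ p +_) (2^-double q) ⟩
  2 ^ p + 2 ^ suc q         ≤⟨ +-monoʳ-≤ (2 ^ p) (^-monoʳ-≤ 2 q<p) ⟩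
  2 ^ p + 2 ^ p             ≡⟨ 2^-double p ⟩
  2 ^ suc p                 ∎)
  where
  open ≤-Reasoning
  reassoc : ∀ a b → a + b + 1 + 1 ≡ a + (b + 2)
  reassoc = solve-∀

oddLog-formB : ∀ {p q} → 1 ≤ p → 1 ≤ q → 3 ≤ p + q → OddLog (p + q) ((2 ^ p + 1) * (2 ^ q + 1))
oddLog-formB {p} {q} p≥1 q≥1 p+q≥3 = lower , upper
  where
  open ≤-Reasoning
  P Q : ℕ
  P = 2 ^ p
  Q = 2 ^ q
  expand : ∀ P Q → (P + 1) * (Q + 1) ≡ P * Q + (P + Q + 1)
  expand = solve-∀
  lower : 2 ^ (p + q) < (P + 1) * (Q + 1)
  lower = begin-strict
    2 ^ (p + q)           ≡⟨ ^-distribˡ-+-* 2 p q ⟩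
    P * Q                 <⟨ m<m+n (P * Q) (m≤n+m 1 (P + Q)) ⟩
    P * Q + (P + Q + 1)   ≡⟨ expand P Q ⟨
    (P + 1) * (Q + 1)     ∎
  P+Q+2≤P*Q : P + Q + 2 ≤ P * Q
  P+Q+2≤P*Q with p ≤? 1
  ... | no p≰1 = m+n+2≤m*n (^-monoʳ-≤ 2 (≰⇒> p≰1)) (^-monoʳ-≤ 2 q≥1)
  ... | yes p≤1 = subst₂ _≤_ (cong (_+ 2) (+-comm Q P)) (*-comm Q P)
                    (m+n+2≤m*n (^-monoʳ-≤ 2 q≥2) (^-monoʳ-≤ 2 p≥1))
    where
    q≥2 : 2 ≤ q
    q≥2 = +-cancelˡ-≤ 1 2 q (≤-trans p+q≥3 (+-monoˡ-≤ q p≤1))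
  upper : (P + 1) * (Q + 1) + 1 ≤ 2 ^ suc (p + q)
  upper = begin
    (P + 1) * (Q + 1) + 1     ≡⟨ cong (_+ 1) (expand P Q) ⟩
    P * Q + (P + Q + 1) + 1   ≡⟨ regroup (P * Q) (P + Q) ⟩
    P * Q + (P + Q + 2)       ≤⟨ +-monoʳ-≤ (P * Q) P+Q+2≤P*Q ⟩
    P * Q + P * Q             ≡⟨ cong (λ m → m + m) (^-distribˡ-+-* 2 p q) ⟨
    2 ^ (p + q) + 2 ^ (p + q) ≡⟨ 2^-double (p + q) ⟩
    2 ^ suc (p + q)           ∎
    where
    regroup : ∀ a b → a + (b + 1) + 1 ≡ a + (b + 2)
    regroup = solve-∀

oddLog-formC : ∀ {u} → 1 ≤ u → OddLog (u + 3) (9 * 2 ^ u + 3)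
oddLog-formC {u} u≥1 = lower , upper
  where
  open ≤-Reasoning
  U : ℕ
  U = 2 ^ u
  2^[u+3]≡ : 2 ^ (u + 3) ≡ U * 8
  2^[u+3]≡ = ^-distribˡ-+-* 2 u 3
  lower : 2 ^ (u + 3) < 9 * U + 3
  lower = begin-strict
    2 ^ (u + 3) ≡⟨ 2^[u+3]≡ ⟩
    U * 8       <⟨ ≤-witness (U + 2) (expand U) ⟩
    9 * U + 3   ∎
    where
    expand : ∀ U → suc (U * 8) + (U + 2) ≡ 9 * U + 3
    expand = solve-∀
  upper : 9 * U + 3 + 1 ≤ 2 ^ suc (u + 3)
  upper with ≤-offset (^-monoʳ-≤ 2 u≥1)
  ... | d , U≡2+d = begin
    9 * U + 3 + 1       ≡⟨ cong (λ U → 9 * U + 3 + 1) U≡2+d ⟩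
    9 * (2 + d) + 3 + 1 ≤⟨ ≤-witness (10 + 7 * d) (expand d) ⟩
    2 * ((2 + d) * 8)   ≡⟨ cong (λ U → 2 * (U * 8)) U≡2+d ⟨
    2 * (U * 8)         ≡⟨ cong (2 *_) 2^[u+3]≡ ⟨
    2 ^ suc (u + 3)     ∎
    where
    expand : ∀ d → 9 * (2 + d) + 3 + 1 + (10 + 7 * d) ≡ 2 * ((2 + d) * 8)
    expand = solve-∀

oddLog-formD : OddLog 7 135
oddLog-formD = ≤-computed , ≤-computed

twoPowers-excess : ∀ {n k} x p → 1 ≤ x → 1 ≤ p → n ≡ 2 ^ x * (2 ^ p + 1) → x + (p + 1) ≤ k → Excess 1 n k
twoPowers-excess x p x≥1 p≥1 eq b = excess x p x≥1 (+-mono-≤ x≥1 p≥1) eq (oddLog-twoPowers p≥1) b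

exceptional-excess : ∀ {n k} → Exceptional n k → Excess 2 n k
exceptional-excess (formA x p q x≥1 q≥1 q<p eq b) =
  excess x p x≥1 (≤-trans (s≤s q≥1) (≤-trans q<p (m≤n+m p x))) eq (oddLog-formA q≥1 q<p) b
exceptional-excess (formB x p q x≥2 p≥1 q≥1 p+q≥3 eq b) =
  excess x (p + q) (m<n⇒0<n x≥2) (≤-trans x≥2 (m≤m+n x _)) eq (oddLog-formB p≥1 q≥1 p+q≥3) b
exceptional-excess (formC x u x≥2 u≥1 eq b) =
  excess x (u + 3) (m<n⇒0<n x≥2) (≤-trans x≥2 (m≤m+n x _)) eq (oddLog-formC u≥1) b
exceptional-excess (formD x x≥3 eq b) =
  excess x 7 (≤-trans ≤-computed x≥3) (≤-trans ≤-computed (m≤n+m 7 x)) eq oddLog-formD b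

≤2*2^log : ∀ {c n k} (e : Excess c n k) → n ≤ 2 * 2 ^ Excess.log e
≤2*2^log e = ≤-trans (m≤m+n _ 2) (Excess.upper e)

sum-excess : ∀ {a b ka kb} → Excess 1 a ka → Excess 1 b kb → 4 * (a + b) ≤ 2 ^ (ka + kb)
sum-excess {a} {b} {ka} {kb} ea eb = begin
  4 * (a + b)                       ≤⟨ *-monoʳ-≤ 4 (+-mono-≤ (≤2*2^log ea) (≤2*2^log eb)) ⟩
  4 * (2 * A + 2 * B)               ≡⟨ cong (4 *_) (*-distribˡ-+ 2 A B) ⟨
  4 * (2 * (A + B))                 ≤⟨ *-monoʳ-≤ 4 (2*[m+n]≤m*n (^-monoʳ-≤ 2 (2≤log ea)) (^-monoʳ-≤ 2 (2≤log eb))) ⟩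
  4 * (A * B)                       ≡⟨ regroup A B ⟩
  2 * A * (2 * B)                   ≡⟨ ^-distribˡ-+-* 2 (suc (log ea)) (suc (log eb)) ⟨
  2 ^ (suc (log ea) + suc (log eb)) ≤⟨ ^-monoʳ-≤ 2 (+-mono-≤ (budget ea) (budget eb)) ⟩
  2 ^ (ka + kb)                     ∎
  where
  open ≤-Reasoning
  open Excess
  A B : ℕ
  A = 2 ^ log ea
  B = 2 ^ log eb
  regroup : ∀ A B → 4 * (A * B) ≡ 2 * A * (2 * B)
  regroup = solve-∀

product-excess : ∀ {a b ka kb} → Excess 2 a ka → Excess 2 b kb → 4 * (a * b) ≤ 2 ^ (ka + kb)
product-excess {a} {b} {ka} {kb} ea eb = begin
  4 * (a * b)                     ≤⟨ *-monoʳ-≤ 4 (*-mono-≤ (≤2*2^log ea) (≤2*2^log eb)) ⟩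
  4 * (2 * A * (2 * B))           ≡⟨ regroup A B ⟩
  2 * (2 * A) * (2 * (2 * B))     ≡⟨ ^-distribˡ-+-* 2 (2 + log ea) (2 + log eb) ⟨
  2 ^ (2 + log ea + (2 + log eb)) ≤⟨ ^-monoʳ-≤ 2 (+-mono-≤ (budget ea) (budget eb)) ⟩
  2 ^ (ka + kb)                   ∎
  where
  open ≤-Reasoning
  open Excess
  A B : ℕ
  A = 2 ^ log ea
  B = 2 ^ log eb
  regroup : ∀ A B → 4 * (2 * A * (2 * B)) ≡ 2 * (2 * A) * (2 * (2 * B))
  regroup = solve-∀

power+excess : ∀ {x b ka kb} → 1 ≤ x → x ≤ ka → Excess 2 b kb → 4 * (2 ^ x + b) ≤ 2 ^ (ka + kb)
power+excess {x} {b} {ka} {kb} x≥1 x≤ka eb = begin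
  4 * (X + b)            ≤⟨ *-monoʳ-≤ 4 X+b≤X*B ⟩
  4 * (X * B)            ≡⟨ regroup X B ⟩
  X * (2 * (2 * B))      ≡⟨ ^-distribˡ-+-* 2 x (2 + log eb) ⟨
  2 ^ (x + (2 + log eb)) ≤⟨ ^-monoʳ-≤ 2 (+-mono-≤ x≤ka (budget eb)) ⟩
  2 ^ (ka + kb)          ∎
  where
  open ≤-Reasoning
  open Excess
  X B : ℕ
  X = 2 ^ x
  B = 2 ^ log eb
  regroup : ∀ X B → 4 * (X * B) ≡ X * (2 * (2 * B))
  regroup = solve-∀
  X+b≤X*B : X + b ≤ X * B
  X+b≤X*B = +-cancelʳ-≤ 2 (X + b) (X * B) (begin
    X + b + 2   ≡⟨ +-assoc X b 2 ⟩
    X + (b + 2) ≤⟨ +-monoʳ-≤ X (upper eb) ⟩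
    X + 2 * B   ≤⟨ m+2*n≤m*n+2 (^-monoʳ-≤ 2 x≥1) (m^n>0 2 (log eb)) ⟩
    X * B + 2   ∎)

generic+ : ∀ {a b ka kb} → 2 ≤ a → 4 * a ≤ 2 ^ ka → 2 ≤ b → b ≤ 2 ^ kb → 4 * (a + b) ≤ 2 ^ (ka + kb)
generic+ {a} {b} {ka} {kb} a≥2 4a≤ b≥2 b≤ = begin
  4 * (a + b)         ≡⟨ *-distribˡ-+ 4 a b ⟩
  4 * a + 4 * b       ≤⟨ +-mono-≤ 4a≤ (*-monoʳ-≤ 4 b≤) ⟩
  2 ^ ka + 4 * 2 ^ kb ≤⟨ m+4*n≤m*n (≤-trans (*-monoʳ-≤ 4 a≥2) 4a≤) (≤-trans b≥2 b≤) ⟩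
  2 ^ ka * 2 ^ kb     ≡⟨ ^-distribˡ-+-* 2 ka kb ⟨
  2 ^ (ka + kb)       ∎
  where open ≤-Reasoning

generic* : ∀ {a b ka kb} → 4 * a ≤ 2 ^ ka → b ≤ 2 ^ kb → 4 * (a * b) ≤ 2 ^ (ka + kb)
generic* {a} {b} {ka} {kb} 4a≤ b≤ = begin
  4 * (a * b)     ≡⟨ *-assoc 4 a b ⟨
  4 * a * b       ≤⟨ *-mono-≤ 4a≤ b≤ ⟩
  2 ^ ka * 2 ^ kb ≡⟨ ^-distribˡ-+-* 2 ka kb ⟨
  2 ^ (ka + kb)   ∎
  where open ≤-Reasoning

power+larger-power : ∀ {k a b} → 1 ≤ a → a < b → b < k → Shape (2 ^ a + 2 ^ b) k
power+larger-power {a = a} a≥1 a<b b<k with <-offset a<b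
... | d , refl = twoPowers a (suc d) a≥1 (s≤s z≤n)
                   (trans (+-comm (2 ^ a) _) (2^[m+n]+2^m a (suc d)))
                   (≤-trans (≤-reflexive (trans (cong (a +_) (+-comm (suc d) 1)) (+-suc a (suc d)))) b<k)

power+power : ∀ {k} x y → 1 ≤ x → 1 ≤ y → x < k → y < k → Shape (2 ^ x + 2 ^ y) k
power+power {k} x y x≥1 y≥1 x<k y<k with <-cmp x y
... | tri< x<y _ _ = power+larger-power x≥1 x<y y<k
... | tri≈ _ refl _ = power (suc x) z<s (2^-double x) x<k
... | tri> _ _ y<x = subst (λ n → Shape n k) (+-comm (2 ^ y) (2 ^ x)) (power+larger-power y≥1 y<x x<k)

ordered-three-powers : ∀ {k a b c} → 1 ≤ a → a < b → b < c → c + 2 ≤ k →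
                       Exceptional (2 ^ a + 2 ^ b + 2 ^ c) k
ordered-three-powers {k} {a} a≥1 a<b b<c c+2≤k with <-offset a<b
... | d , refl with <-offset b<c
...   | e , refl = formA a (suc d + suc e) (suc d) a≥1 z<s (m<m+n (suc d) z<s) factored budget
  where
  factor : ∀ A D E → A + A * D + A * E ≡ A * (E + D + 1)
  factor = solve-∀
  factored : 2 ^ a + 2 ^ (a + suc d) + 2 ^ (a + suc d + suc e) ≡ 2 ^ a * (2 ^ (suc d + suc e) + 2 ^ suc d + 1)
  factored = begin
    2 ^ a + 2 ^ (a + suc d) + 2 ^ (a + suc d + suc e)
      ≡⟨ cong (λ m → 2 ^ a + 2 ^ (a + suc d) + 2 ^ m) (+-assoc a (suc d) (suc e)) ⟩
    2 ^ a + 2 ^ (a + suc d) + 2 ^ (a + (suc d + suc e))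
      ≡⟨ cong₂ (λ u v → 2 ^ a + u + v) (^-distribˡ-+-* 2 a (suc d)) (^-distribˡ-+-* 2 a (suc d + suc e)) ⟩
    2 ^ a + 2 ^ a * 2 ^ suc d + 2 ^ a * 2 ^ (suc d + suc e)
      ≡⟨ factor (2 ^ a) (2 ^ suc d) (2 ^ (suc d + suc e)) ⟩
    2 ^ a * (2 ^ (suc d + suc e) + 2 ^ suc d + 1)
      ∎
    where open ≡-Reasoning
  reassoc : ∀ a d e → a + (d + e + 2) ≡ a + d + e + 2
  reassoc = solve-∀
  budget : a + (suc d + suc e + 2) ≤ k
  budget = ≤-trans (≤-reflexive (reassoc a (suc d) (suc e))) c+2≤k

power+twoPowers : ∀ {ka kb} x y p → 1 ≤ x → 1 ≤ y → 1 ≤ p → x ≤ ka → y + (p + 1) ≤ kb →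
                  Shape (2 ^ x + 2 ^ y * (2 ^ p + 1)) (ka + kb)
power+twoPowers {ka} {kb} x y p x≥1 y≥1 p≥1 x≤ka b =
  subst (λ n → Shape n (ka + kb)) (cong (2 ^ x +_) (trans (+-comm (2 ^ y) (2 ^ (y + p))) (2^[m+n]+2^m y p))) three-powers
  where
  open ≤-Reasoning
  k : ℕ
  k = ka + kb
  x+2≤k : x + 2 ≤ k
  x+2≤k = +-mono-≤ x≤ka (≤-trans (+-mono-≤ y≥1 (m≤n+m 1 p)) b)
  y+p+2≤k : y + p + 2 ≤ k
  y+p+2≤k = begin
    y + p + 2       ≡⟨ reassoc y p ⟩
    y + (p + 1) + 1 ≤⟨ +-mono-≤ b (≤-trans x≥1 x≤ka) ⟩
    kb + ka         ≡⟨ +-comm kb ka ⟩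
    k               ∎
    where
    reassoc : ∀ y p → y + p + 2 ≡ y + (p + 1) + 1
    reassoc = solve-∀
  y+p<k : y + p < k
  y+p<k = <-≤-trans (m<m+n (y + p) z<s) y+p+2≤k
  suc-y+p<k : suc (y + p) < k
  suc-y+p<k = ≤-trans (≤-reflexive (+-comm 2 (y + p))) y+p+2≤k
  y<y+p : y < y + p
  y<y+p = m<m+n y p≥1
  swap-front : ∀ a b c → b + a + c ≡ a + (b + c)
  swap-front = solve-∀
  absorb : ∀ a b → a + (b + b) ≡ b + (a + b)
  absorb = solve-∀
  three-powers : Shape (2 ^ x + (2 ^ y + 2 ^ (y + p))) k
  three-powers with <-cmp x y
  ... | tri< x<y _ _ =
    exceptional (subst (λ n → Exceptional n k) (+-assoc (2 ^ x) (2 ^ y) (2 ^ (y + p)))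
                   (ordered-three-powers x≥1 x<y y<y+p y+p+2≤k))
  ... | tri≈ _ refl _ =
    subst (λ n → Shape n k) (trans (cong (_+ 2 ^ (x + p)) (sym (2^-double x))) (+-assoc (2 ^ x) (2 ^ x) (2 ^ (x + p))))
      (power+power (suc x) (x + p) z<s (≤-trans y≥1 (m≤m+n y p))
                   (≤-trans (≤-reflexive (+-comm 2 x)) x+2≤k) y+p<k)
  ... | tri> _ _ y<x with <-cmp x (y + p)
  ...   | tri< x<y+p _ _ =
    exceptional (subst (λ n → Exceptional n k) (swap-front (2 ^ x) (2 ^ y) (2 ^ (y + p)))
                   (ordered-three-powers y≥1 y<x x<y+p y+p+2≤k))
  ...   | tri≈ _ refl _ =
    subst (λ n → Shape n k) (trans (cong (2 ^ y +_) (sym (2^-double (y + p)))) (absorb (2 ^ y) (2 ^ (y + p))))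
      (power+power y (suc (y + p)) y≥1 z<s (<-trans y<y+p y+p<k) suc-y+p<k)
  ...   | tri> _ _ y+p<x =
    exceptional (subst (λ n → Exceptional n k) (+-comm (2 ^ y + 2 ^ (y + p)) (2 ^ x))
                   (ordered-three-powers y≥1 y<y+p y+p<x x+2≤k))

+-shape : ∀ {a b ka kb} → 2 ≤ a → a ≤ 2 ^ ka → 2 ≤ b → b ≤ 2 ^ kb →
          Shape a ka → Shape b kb → Shape (a + b) (ka + kb)
+-shape {a} {b} {ka} {kb} a≥2 _ b≥2 b≤ (generic 4a≤) _ =
  generic (generic+ {a} {b} {ka} {kb} a≥2 4a≤ b≥2 b≤)
+-shape {a} {b} {ka} {kb} a≥2 a≤ b≥2 _ _ (generic 4b≤) =
  +-shape-comm {a} {b} {ka} {kb} (generic (generic+ {b} {a} {kb} {ka} b≥2 4b≤ a≥2 a≤))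
+-shape _ _ _ _ (power x x≥1 refl x≤ka) (power y y≥1 refl y≤kb) =
  power+power x y x≥1 y≥1 (≤-<-trans x≤ka (m<m+n _ (≤-trans y≥1 y≤kb)))
                           (≤-<-trans y≤kb (m<n+m _ (≤-trans x≥1 x≤ka)))
+-shape _ _ _ _ (power x x≥1 refl x≤ka) (twoPowers y p y≥1 p≥1 refl b) =
  power+twoPowers x y p x≥1 y≥1 p≥1 x≤ka b
+-shape {ka = ka} {kb} _ _ _ _ (twoPowers y p y≥1 p≥1 refl b) (power x x≥1 refl x≤kb) =
  +-shape-comm {2 ^ y * (2 ^ p + 1)} {2 ^ x} {ka} {kb} (power+twoPowers x y p x≥1 y≥1 p≥1 x≤kb b)
+-shape _ _ _ _ (power x x≥1 refl x≤ka) (exceptional e) =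
  generic (power+excess x≥1 x≤ka (exceptional-excess e))
+-shape {a} {ka = ka} {kb} _ _ _ _ (exceptional e) (power x x≥1 refl x≤kb) =
  +-shape-comm {a} {ka = ka} {kb} (generic (power+excess x≥1 x≤kb (exceptional-excess e)))
+-shape _ _ _ _ (twoPowers x p x≥1 p≥1 ea ba) (twoPowers y q y≥1 q≥1 eb bb) =
  generic (sum-excess (twoPowers-excess x p x≥1 p≥1 ea ba) (twoPowers-excess y q y≥1 q≥1 eb bb))
+-shape _ _ _ _ (twoPowers x p x≥1 p≥1 ea ba) (exceptional e) =
  generic (sum-excess (twoPowers-excess x p x≥1 p≥1 ea ba) (excess-2⇒1 (exceptional-excess e)))
+-shape _ _ _ _ (exceptional e) (twoPowers y q y≥1 q≥1 eb bb) =
  generic (sum-excess (excess-2⇒1 (exceptional-excess e)) (twoPowers-excess y q y≥1 q≥1 eb bb))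
+-shape _ _ _ _ (exceptional e) (exceptional f) =
  generic (sum-excess (excess-2⇒1 (exceptional-excess e)) (excess-2⇒1 (exceptional-excess f)))

2^*-* : ∀ {a b} x y {o o′} → a ≡ 2 ^ x * o → b ≡ 2 ^ y * o′ → a * b ≡ 2 ^ (x + y) * (o * o′)
2^*-* x y {o} {o′} refl refl = begin
  2 ^ x * o * (2 ^ y * o′) ≡⟨ interchange (2 ^ x) o (2 ^ y) o′ ⟩
  2 ^ x * 2 ^ y * (o * o′) ≡⟨ cong (_* (o * o′)) (^-distribˡ-+-* 2 x y) ⟨
  2 ^ (x + y) * (o * o′)   ∎
  where
  open ≡-Reasoning
  interchange : ∀ a b c d → a * b * (c * d) ≡ a * c * (b * d)
  interchange = solve-∀

+-budget : ∀ x y {s t ka kb} → x + s ≤ ka → y + t ≤ kb → x + y + (s + t) ≤ ka + kb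
+-budget x y {s} {t} x+s≤ka y+t≤kb = ≤-trans (≤-reflexive (interchange x y s t)) (+-mono-≤ x+s≤ka y+t≤kb)
  where
  interchange : ∀ x y s t → x + y + (s + t) ≡ x + s + (y + t)
  interchange = solve-∀

slack : ∀ z {m n k} → m ≤ n → z + n ≤ k → z + m ≤ k
slack z m≤n b = ≤-trans (+-monoʳ-≤ z m≤n) b

generic-product : ∀ {n k} z p t {o} → n ≡ 2 ^ z * o → o ≤ 2 ^ suc (p + t) →
                  z + (p + 1 + (t + 2)) ≤ k → 4 * n ≤ 2 ^ k
generic-product {k = k} z p t {o} refl o≤ b = begin
  4 * (2 ^ z * o)                     ≤⟨ *-monoʳ-≤ 4 (*-monoʳ-≤ (2 ^ z) o≤) ⟩
  4 * (2 ^ z * 2 ^ suc (p + t))       ≡⟨ regroup (2 ^ z) (2 ^ suc (p + t)) ⟩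
  2 ^ z * (2 * (2 * 2 ^ suc (p + t))) ≡⟨ ^-distribˡ-+-* 2 z (2 + suc (p + t)) ⟨
  2 ^ (z + (2 + suc (p + t)))         ≡⟨ cong (λ m → 2 ^ (z + m)) (exponent p t) ⟩
  2 ^ (z + (p + 1 + (t + 2)))         ≤⟨ ^-monoʳ-≤ 2 b ⟩
  2 ^ k                               ∎
  where
  open ≤-Reasoning
  regroup : ∀ Z M → 4 * (Z * M) ≡ Z * (2 * (2 * M))
  regroup = solve-∀
  exponent : ∀ p t → 2 + suc (p + t) ≡ p + 1 + (t + 2)
  exponent = solve-∀

2^j*[2^p+1]≤[2^j+1]*2^p : ∀ {j p} → j ≤ p → 2 ^ j * (2 ^ p + 1) ≤ (2 ^ j + 1) * 2 ^ p
2^j*[2^p+1]≤[2^j+1]*2^p {j} {p} j≤p = begin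
  2 ^ j * (2 ^ p + 1)   ≡⟨ expandˡ (2 ^ j) (2 ^ p) ⟩
  2 ^ j * 2 ^ p + 2 ^ j ≤⟨ +-monoʳ-≤ (2 ^ j * 2 ^ p) (^-monoʳ-≤ 2 j≤p) ⟩
  2 ^ j * 2 ^ p + 2 ^ p ≡⟨ expandʳ (2 ^ j) (2 ^ p) ⟨
  (2 ^ j + 1) * 2 ^ p   ∎
  where
  open ≤-Reasoning
  expandˡ : ∀ J P → J * (P + 1) ≡ J * P + J
  expandˡ = solve-∀
  expandʳ : ∀ J P → (J + 1) * P ≡ J * P + P
  expandʳ = solve-∀

-- (2^p + 1)/2^p decreases with p, so a bound at (i, j, l) holds at all larger exponents.
three-factor-bound-from : ∀ i j l {p q s} → i ≤ p → j ≤ q → l ≤ s →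
  (2 ^ i + 1) * ((2 ^ j + 1) * (2 ^ l + 1)) ≤ 2 ^ suc (i + (j + l)) →
  (2 ^ p + 1) * ((2 ^ q + 1) * (2 ^ s + 1)) ≤ 2 ^ suc (p + (q + s))
three-factor-bound-from i j l {p} {q} {s} i≤p j≤q l≤s base =
  *-cancelˡ-≤ (2 ^ (i + (j + l))) {{m^n≢0 2 (i + (j + l))}} (begin
    2 ^ (i + (j + l)) * ((P + 1) * ((Q + 1) * (S + 1)))  ≡⟨ cong (_* ((P + 1) * ((Q + 1) * (S + 1)))) (2^-distrib₃ i j l) ⟩
    A * (B * C) * ((P + 1) * ((Q + 1) * (S + 1)))        ≡⟨ distribute A B C P Q S ⟩
    (A * (P + 1)) * ((B * (Q + 1)) * (C * (S + 1)))      ≤⟨ *-mono-≤ (shrink i≤p) (*-mono-≤ (shrink j≤q) (shrink l≤s)) ⟩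
    ((A + 1) * P) * (((B + 1) * Q) * ((C + 1) * S))      ≡⟨ collect A B C P Q S ⟩
    (A + 1) * ((B + 1) * (C + 1)) * (P * (Q * S))        ≤⟨ *-monoˡ-≤ (P * (Q * S)) base ⟩
    2 * 2 ^ (i + (j + l)) * (P * (Q * S))                ≡⟨ cong (2 * 2 ^ (i + (j + l)) *_) (2^-distrib₃ p q s) ⟨
    2 * 2 ^ (i + (j + l)) * 2 ^ (p + (q + s))            ≡⟨ *-comm-middle 2 (2 ^ (i + (j + l))) (2 ^ (p + (q + s))) ⟩
    2 ^ (i + (j + l)) * 2 ^ suc (p + (q + s))            ∎)
  where
  open ≤-Reasoning
  shrink : ∀ {j p} → j ≤ p → 2 ^ j * (2 ^ p + 1) ≤ (2 ^ j + 1) * 2 ^ p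
  shrink = 2^j*[2^p+1]≤[2^j+1]*2^p
  A B C P Q S : ℕ
  A = 2 ^ i
  B = 2 ^ j
  C = 2 ^ l
  P = 2 ^ p
  Q = 2 ^ q
  S = 2 ^ s
  distribute : ∀ A B C P Q S → A * (B * C) * ((P + 1) * ((Q + 1) * (S + 1))) ≡ (A * (P + 1)) * ((B * (Q + 1)) * (C * (S + 1)))
  distribute = solve-∀
  collect : ∀ A B C P Q S → ((A + 1) * P) * (((B + 1) * Q) * ((C + 1) * S)) ≡ (A + 1) * ((B + 1) * (C + 1)) * (P * (Q * S))
  collect = solve-∀
  *-comm-middle : ∀ a b c → a * b * c ≡ b * (a * c)
  *-comm-middle = solve-∀

data SmallTriple : ℕ → ℕ → ℕ → Set where
  1-1-x : ∀ t → SmallTriple 1 1 t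
  1-x-1 : ∀ t → SmallTriple 1 t 1
  x-1-1 : ∀ t → SmallTriple t 1 1
  1-2-2 : SmallTriple 1 2 2
  2-1-2 : SmallTriple 2 1 2
  2-2-1 : SmallTriple 2 2 1
  1-2-3 : SmallTriple 1 2 3
  1-3-2 : SmallTriple 1 3 2
  2-1-3 : SmallTriple 2 1 3
  2-3-1 : SmallTriple 2 3 1
  3-1-2 : SmallTriple 3 1 2
  3-2-1 : SmallTriple 3 2 1

three-factor-bound : ∀ p q s → 1 ≤ p → 1 ≤ q → 1 ≤ s →
  (2 ^ p + 1) * ((2 ^ q + 1) * (2 ^ s + 1)) ≤ 2 ^ suc (p + (q + s)) ⊎ SmallTriple p q s
three-factor-bound 0 _ _ () _ _
three-factor-bound _ 0 _ _ () _
three-factor-bound _ _ 0 _ _ ()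
three-factor-bound 1 1 s _ _ _ = inj₂ (1-1-x s)
three-factor-bound 1 q 1 _ _ _ = inj₂ (1-x-1 q)
three-factor-bound p 1 1 _ _ _ = inj₂ (x-1-1 p)
three-factor-bound 1 2 2 _ _ _ = inj₂ 1-2-2
three-factor-bound 2 1 2 _ _ _ = inj₂ 2-1-2
three-factor-bound 2 2 1 _ _ _ = inj₂ 2-2-1
three-factor-bound 1 2 3 _ _ _ = inj₂ 1-2-3
three-factor-bound 1 3 2 _ _ _ = inj₂ 1-3-2
three-factor-bound 2 1 3 _ _ _ = inj₂ 2-1-3
three-factor-bound 2 3 1 _ _ _ = inj₂ 2-3-1
three-factor-bound 3 1 2 _ _ _ = inj₂ 3-1-2
three-factor-bound 3 2 1 _ _ _ = inj₂ 3-2-1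
three-factor-bound 1 2 (suc (suc (suc (suc s)))) _ _ _ =
  inj₁ (three-factor-bound-from 1 2 4 ≤-refl ≤-refl (m≤m+n 4 s) ≤-computed)
three-factor-bound 1 (suc (suc (suc (suc q)))) 2 _ _ _ =
  inj₁ (three-factor-bound-from 1 4 2 ≤-refl (m≤m+n 4 q) ≤-refl ≤-computed)
three-factor-bound 1 (suc (suc (suc q))) (suc (suc (suc s))) _ _ _ =
  inj₁ (three-factor-bound-from 1 3 3 ≤-refl (m≤m+n 3 q) (m≤m+n 3 s) ≤-computed)
three-factor-bound 2 1 (suc (suc (suc (suc s)))) _ _ _ =
  inj₁ (three-factor-bound-from 2 1 4 ≤-refl ≤-refl (m≤m+n 4 s) ≤-computed)
three-factor-bound (suc (suc (suc (suc p)))) 1 2 _ _ _ =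
  inj₁ (three-factor-bound-from 4 1 2 (m≤m+n 4 p) ≤-refl ≤-refl ≤-computed)
three-factor-bound (suc (suc (suc p))) 1 (suc (suc (suc s))) _ _ _ =
  inj₁ (three-factor-bound-from 3 1 3 (m≤m+n 3 p) ≤-refl (m≤m+n 3 s) ≤-computed)
three-factor-bound 2 (suc (suc (suc (suc q)))) 1 _ _ _ =
  inj₁ (three-factor-bound-from 2 4 1 ≤-refl (m≤m+n 4 q) ≤-refl ≤-computed)
three-factor-bound (suc (suc (suc (suc p)))) 2 1 _ _ _ =
  inj₁ (three-factor-bound-from 4 2 1 (m≤m+n 4 p) ≤-refl ≤-refl ≤-computed)
three-factor-bound (suc (suc (suc p))) (suc (suc (suc q))) 1 _ _ _ =
  inj₁ (three-factor-bound-from 3 3 1 (m≤m+n 3 p) (m≤m+n 3 q) ≤-refl ≤-computed)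
three-factor-bound (suc (suc p)) (suc (suc q)) (suc (suc s)) _ _ _ =
  inj₁ (three-factor-bound-from 2 2 2 (m≤m+n 2 p) (m≤m+n 2 q) (m≤m+n 2 s) ≤-computed)

p+q+2≡[p+1]+[q+1] : ∀ p q → p + q + 2 ≡ p + 1 + (q + 1)
p+q+2≡[p+1]+[q+1] = solve-∀

twoPowers*twoPowers : ∀ {n k} z p q → 2 ≤ z → 1 ≤ p → 1 ≤ q →
  n ≡ 2 ^ z * ((2 ^ p + 1) * (2 ^ q + 1)) → z + (p + 1 + (q + 1)) ≤ k → Shape n k
twoPowers*twoPowers z 0 _ _ () _ _ _
twoPowers*twoPowers z _ 0 _ _ () _ _
twoPowers*twoPowers z 1 1 z≥2 _ _ eq b = twoPowers z 3 (m<n⇒0<n z≥2) z<s eq b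
twoPowers*twoPowers z 1 q@(suc (suc q′)) z≥2 p≥1 q≥1 eq b =
  exceptional (formB z 1 q z≥2 p≥1 q≥1 (m≤m+n 3 q′) eq (slack z (≤-reflexive (p+q+2≡[p+1]+[q+1] 1 q)) b))
twoPowers*twoPowers z p@(suc (suc p′)) q z≥2 p≥1 q≥1 eq b =
  exceptional (formB z p q z≥2 p≥1 q≥1 (+-mono-≤ (m≤m+n 2 p′) q≥1) eq (slack z (≤-reflexive (p+q+2≡[p+1]+[q+1] p q)) b))

3*[2^[4+d]+3]≤2^[6+d] : ∀ d → 3 * (2 ^ (4 + d) + 2 + 1) ≤ 2 ^ (6 + d)
3*[2^[4+d]+3]≤2^[6+d] d with ≤-offset (m^n>0 2 d)
... | e , 2^d≡1+e = begin
  3 * (2 ^ (4 + d) + 2 + 1) ≡⟨ cong (λ m → 3 * (m + 2 + 1)) (trans (^-distribˡ-+-* 2 4 d) (cong (16 *_) 2^d≡1+e)) ⟩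
  3 * (16 * (1 + e) + 2 + 1) ≤⟨ ≤-witness (7 + 16 * e) (expand e) ⟩
  64 * (1 + e)              ≡⟨ trans (^-distribˡ-+-* 2 6 d) (cong (64 *_) 2^d≡1+e) ⟨
  2 ^ (6 + d)               ∎
  where
  open ≤-Reasoning
  expand : ∀ e → 3 * (16 * (1 + e) + 2 + 1) + (7 + 16 * e) ≡ 64 * (1 + e)
  expand = solve-∀

[2^[3+p]+1]*7≤2^[6+p] : ∀ p → (2 ^ (3 + p) + 1) * 7 ≤ 2 ^ suc (3 + p + 2)
[2^[3+p]+1]*7≤2^[6+p] p with ≤-offset (m^n>0 2 p)
... | e , 2^p≡1+e = begin
  (2 ^ (3 + p) + 1) * 7   ≡⟨ cong (λ m → (m + 1) * 7) (trans (^-distribˡ-+-* 2 3 p) (cong (8 *_) 2^p≡1+e)) ⟩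
  (8 * (1 + e) + 1) * 7   ≤⟨ ≤-witness (1 + 8 * e) (expand e) ⟩
  64 * (1 + e)            ≡⟨ trans (^-distribˡ-+-* 2 6 p) (cong (64 *_) 2^p≡1+e) ⟨
  2 ^ (6 + p)             ≡⟨ cong (λ m → 2 ^ (4 + m)) (+-comm 2 p) ⟩
  2 ^ suc (3 + p + 2)     ∎
  where
  open ≤-Reasoning
  expand : ∀ e → (8 * (1 + e) + 1) * 7 + (1 + 8 * e) ≡ 64 * (1 + e)
  expand = solve-∀

3*[2^Q+3]-shape : ∀ {n k} z d → 2 ≤ z → n ≡ 2 ^ z * (3 * (2 ^ (2 + d) + 2 + 1)) →
                  z + (2 + (2 + d + 2)) ≤ k → Shape n k
3*[2^Q+3]-shape z 0 z≥2 eq b = exceptional (formC z 1 z≥2 ≤-refl eq b)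
3*[2^Q+3]-shape z 1 z≥2 eq b = twoPowers z 5 (m<n⇒0<n z≥2) z<s eq (slack z ≤-computed b)
3*[2^Q+3]-shape z (suc (suc d)) _ eq b = generic (generic-product z 1 (4 + d) eq (3*[2^[4+d]+3]≤2^[6+d] d) b)

[2^p+1]*7-shape : ∀ {n k} z p → 2 ≤ z → 1 ≤ p → n ≡ 2 ^ z * ((2 ^ p + 1) * 7) →
                  z + (p + 1 + 4) ≤ k → Shape n k
[2^p+1]*7-shape z 1 z≥2 _ eq b = exceptional (formC z 1 z≥2 ≤-refl eq b)
[2^p+1]*7-shape z 2 z≥2 _ eq b = exceptional (formA z 5 1 (m<n⇒0<n z≥2) ≤-refl ≤-computed eq b)
[2^p+1]*7-shape z (suc (suc (suc p))) _ _ eq b =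
  generic (generic-product z (3 + p) 2 eq ([2^[3+p]+1]*7≤2^[6+p] p) b)

formA-odd≤ : ∀ s d → 2 ^ (s + suc d) + 2 ^ s + 1 ≤ (2 ^ suc d + 1) * (2 ^ s + 1)
formA-odd≤ s d = ≤-witness (2 ^ suc d) (begin
  2 ^ (s + suc d) + 2 ^ s + 1 + 2 ^ suc d   ≡⟨ cong (λ m → m + 2 ^ s + 1 + 2 ^ suc d) (^-distribˡ-+-* 2 s (suc d)) ⟩
  2 ^ s * 2 ^ suc d + 2 ^ s + 1 + 2 ^ suc d ≡⟨ expand (2 ^ s) (2 ^ suc d) ⟩
  (2 ^ suc d + 1) * (2 ^ s + 1)             ∎)
  where
  open ≡-Reasoning
  expand : ∀ S D → S * D + S + 1 + D ≡ (D + 1) * (S + 1)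
  expand = solve-∀

3*[2^[t+1]+2^t+1]≡9*2^t+3 : ∀ t → 3 * (2 ^ (t + 1) + 2 ^ t + 1) ≡ 9 * 2 ^ t + 3
3*[2^[t+1]+2^t+1]≡9*2^t+3 t = trans (cong (λ m → 3 * (m + 2 ^ t + 1)) (^-distribˡ-+-* 2 t 1)) (expand (2 ^ t))
  where
  expand : ∀ T → 3 * (T * 2 + T + 1) ≡ 9 * T + 3
  expand = solve-∀

-- Through 2^Q + 2^s + 1 ≤ (2^(Q∸s) + 1)(2^s + 1); the products this estimate misses are evaluated.
twoPowers*formA : ∀ {n k} z p Q s → 2 ≤ z → 1 ≤ p → 1 ≤ s → s < Q →
  n ≡ 2 ^ z * ((2 ^ p + 1) * (2 ^ Q + 2 ^ s + 1)) → z + (p + 1 + (Q + 2)) ≤ k → Shape n k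
twoPowers*formA z p Q s z≥2 p≥1 s≥1 s<Q eq b with <-offset s<Q
... | d , refl with three-factor-bound p (suc d) s p≥1 z<s s≥1
...   | inj₁ bound = generic (generic-product z p (s + suc d) eq odd≤ b)
  where
  odd≤ : (2 ^ p + 1) * (2 ^ (s + suc d) + 2 ^ s + 1) ≤ 2 ^ suc (p + (s + suc d))
  odd≤ = ≤-trans (*-monoʳ-≤ (2 ^ p + 1) (formA-odd≤ s d))
           (≤-trans bound (≤-reflexive (cong (λ m → 2 ^ suc (p + m)) (+-comm (suc d) s))))
...   | inj₂ (1-1-x s) = exceptional (formC z s z≥2 s≥1
                           (trans eq (cong (2 ^ z *_) (3*[2^[t+1]+2^t+1]≡9*2^t+3 s)))
                           (slack z (≤-reflexive (regroup s)) b))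
  where
  regroup : ∀ s → s + 3 + 2 ≡ 1 + 1 + (s + 1 + 2)
  regroup = solve-∀
...   | inj₂ (1-x-1 _) = 3*[2^Q+3]-shape z d z≥2 eq b
...   | inj₂ (x-1-1 p) = [2^p+1]*7-shape z p z≥2 p≥1 eq b
...   | inj₂ 1-2-2 = generic (generic-product z 1 4 eq ≤-computed b)
...   | inj₂ 2-1-2 = twoPowers z 6 (m<n⇒0<n z≥2) z<s eq (slack z ≤-computed b)
...   | inj₂ 2-2-1 = generic (generic-product z 2 3 eq ≤-computed b)
...   | inj₂ 1-2-3 = generic (generic-product z 1 5 eq ≤-computed b)
...   | inj₂ 1-3-2 = generic (generic-product z 1 5 eq ≤-computed b)
...   | inj₂ 2-1-3 = generic (generic-product z 2 4 eq ≤-computed b)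
...   | inj₂ 2-3-1 = generic (generic-product z 2 4 eq ≤-computed b)
...   | inj₂ 3-1-2 = generic (generic-product z 3 3 eq ≤-computed b)
...   | inj₂ 3-2-1 = generic (generic-product z 3 3 eq ≤-computed b)

twoPowers*formB : ∀ {n k} z p q s → 3 ≤ z → 1 ≤ p → 1 ≤ q → 1 ≤ s →
  n ≡ 2 ^ z * ((2 ^ p + 1) * ((2 ^ q + 1) * (2 ^ s + 1))) → z + (p + 1 + (q + s + 2)) ≤ k → Shape n k
twoPowers*formB z p q s z≥3 p≥1 q≥1 s≥1 eq b with three-factor-bound p q s p≥1 q≥1 s≥1
... | inj₁ bound = generic (generic-product z p (q + s) eq bound b)
... | inj₂ (1-1-x t) =
  exceptional (formB z 3 t (≤-trans (n≤1+n 2) z≥3) z<s s≥1 (m≤m+n 3 t)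
                 (trans eq (cong (2 ^ z *_) (sym (*-assoc 3 3 (2 ^ t + 1))))) b)
... | inj₂ (1-x-1 t) =
  exceptional (formB z 3 t (≤-trans (n≤1+n 2) z≥3) z<s q≥1 (m≤m+n 3 t)
                 (trans eq (cong (2 ^ z *_) (regroup (2 ^ t + 1)))) (slack z (≤-reflexive (budget t)) b))
  where
  regroup : ∀ T → 3 * (T * 3) ≡ 9 * T
  regroup = solve-∀
  budget : ∀ t → 3 + t + 2 ≡ 1 + 1 + (t + 1 + 2)
  budget = solve-∀
... | inj₂ (x-1-1 t) =
  exceptional (formB z 3 t (≤-trans (n≤1+n 2) z≥3) z<s p≥1 (m≤m+n 3 t)
                 (trans eq (cong (2 ^ z *_) (*-comm (2 ^ t + 1) 9))) (slack z (≤-reflexive (budget t)) b))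
  where
  budget : ∀ t → 3 + t + 2 ≡ t + 1 + (1 + 1 + 2)
  budget = solve-∀
... | inj₂ 1-2-2 = exceptional (formC z 3 (≤-trans (n≤1+n 2) z≥3) z<s eq b)
... | inj₂ 2-1-2 = exceptional (formC z 3 (≤-trans (n≤1+n 2) z≥3) z<s eq b)
... | inj₂ 2-2-1 = exceptional (formC z 3 (≤-trans (n≤1+n 2) z≥3) z<s eq b)
... | inj₂ 1-2-3 = exceptional (formD z z≥3 eq b)
... | inj₂ 1-3-2 = exceptional (formD z z≥3 eq b)
... | inj₂ 2-1-3 = exceptional (formD z z≥3 eq b)
... | inj₂ 2-3-1 = exceptional (formD z z≥3 eq b)
... | inj₂ 3-1-2 = exceptional (formD z z≥3 eq b)
... | inj₂ 3-2-1 = exceptional (formD z z≥3 eq b)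

twoPowers*formC : ∀ {n k} z p u → 1 ≤ p → 1 ≤ u →
  n ≡ 2 ^ z * ((2 ^ p + 1) * (9 * 2 ^ u + 3)) → z + (p + 1 + (u + 3 + 2)) ≤ k → 4 * n ≤ 2 ^ k
twoPowers*formC z p u p≥1 u≥1 eq b with three-factor-bound p 3 u p≥1 z<s u≥1
... | inj₁ bound = generic-product z p (u + 3) eq odd≤ b
  where
  odd≤ : (2 ^ p + 1) * (9 * 2 ^ u + 3) ≤ 2 ^ suc (p + (u + 3))
  odd≤ = ≤-trans (*-monoʳ-≤ (2 ^ p + 1) (+-monoʳ-≤ (9 * 2 ^ u) ≤-computed))
           (≤-trans (≤-trans (≤-reflexive (cong ((2 ^ p + 1) *_) (sym (*-distribˡ-+ 9 (2 ^ u) 1)))) bound)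
             (≤-reflexive (cong (λ m → 2 ^ suc (p + m)) (+-comm 3 u))))
... | inj₂ (1-x-1 _) = generic-product z 1 4 eq ≤-computed b
... | inj₂ 1-3-2 = generic-product z 1 5 eq ≤-computed b
... | inj₂ 2-3-1 = generic-product z 2 4 eq ≤-computed b

twoPowers*formD : ∀ {n k} z p → 1 ≤ p → n ≡ 2 ^ z * ((2 ^ p + 1) * 135) →
                  z + (p + 1 + (7 + 2)) ≤ k → 4 * n ≤ 2 ^ k
twoPowers*formD z p p≥1 eq b with three-factor-bound p 3 4 p≥1 z<s z<s
... | inj₁ bound = generic-product z p 7 eq (≤-trans (*-monoʳ-≤ (2 ^ p + 1) ≤-computed) bound) b

twoPowers*exceptional : ∀ {a b ka kb} x p → 1 ≤ x → 1 ≤ p → a ≡ 2 ^ x * (2 ^ p + 1) →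
                        x + (p + 1) ≤ ka → Exceptional b kb → Shape (a * b) (ka + kb)
twoPowers*exceptional x p x≥1 p≥1 ea ba (formA y Q s y≥1 s≥1 s<Q eb bb) =
  twoPowers*formA (x + y) p Q s (+-mono-≤ x≥1 y≥1) p≥1 s≥1 s<Q (2^*-* x y ea eb) (+-budget x y ba bb)
twoPowers*exceptional x p x≥1 p≥1 ea ba (formB y q s y≥2 q≥1 s≥1 _ eb bb) =
  twoPowers*formB (x + y) p q s (+-mono-≤ x≥1 y≥2) p≥1 q≥1 s≥1 (2^*-* x y ea eb) (+-budget x y ba bb)
twoPowers*exceptional x p _ p≥1 ea ba (formC y u _ u≥1 eb bb) =
  generic (twoPowers*formC (x + y) p u p≥1 u≥1 (2^*-* x y ea eb) (+-budget x y ba bb))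
twoPowers*exceptional x p _ p≥1 ea ba (formD y _ eb bb) =
  generic (twoPowers*formD (x + y) p p≥1 (2^*-* x y ea eb) (+-budget x y ba bb))

*-shape : ∀ {a b ka kb} → a ≤ 2 ^ ka → b ≤ 2 ^ kb → Shape a ka → Shape b kb → Shape (a * b) (ka + kb)
*-shape {a} {b} {ka} {kb} _ b≤ (generic 4a≤) _ = generic (generic* {a} {b} {ka} {kb} 4a≤ b≤)
*-shape {a} {b} {ka} {kb} a≤ _ _ (generic 4b≤) =
  *-shape-comm {a} {b} {ka} {kb} (generic (generic* {b} {a} {kb} {ka} 4b≤ a≤))
*-shape {kb = kb} _ _ (power x _ refl x≤ka) sb = weaken (+-monoˡ-≤ kb x≤ka) (shift x sb)
*-shape {a} {b} {ka} {kb} _ _ sa (power y _ refl y≤kb) =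
  *-shape-comm {a} {b} {ka} {kb} (weaken (+-monoˡ-≤ ka y≤kb) (shift y sa))
*-shape _ _ (twoPowers x p x≥1 p≥1 ea ba) (twoPowers y q y≥1 q≥1 eb bb) =
  twoPowers*twoPowers (x + y) p q (+-mono-≤ x≥1 y≥1) p≥1 q≥1 (2^*-* x y ea eb) (+-budget x y ba bb)
*-shape _ _ (twoPowers x p x≥1 p≥1 ea ba) (exceptional e) = twoPowers*exceptional x p x≥1 p≥1 ea ba e
*-shape {a} {b} {ka} {kb} _ _ (exceptional e) (twoPowers y q y≥1 q≥1 eb bb) =
  *-shape-comm {a} {b} {ka} {kb} (twoPowers*exceptional y q y≥1 q≥1 eb bb e)
*-shape _ _ (exceptional e) (exceptional f) =
  generic (product-excess (exceptional-excess e) (exceptional-excess f))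

shape : ∀ e → Shape (eval e) (copies e)
shape two = power 1 ≤-refl refl ≤-refl
shape (e ⊕ f) = +-shape (eval≥2 e) (eval≤2^copies e) (eval≥2 f) (eval≤2^copies f) (shape e) (shape f)
shape (e ⊗ f) = *-shape (eval≤2^copies e) (eval≤2^copies f) (shape e) (shape f)

Form : ℕ → ℕ → Set
Form m n = FormA m n ⊎ FormB m n ⊎ FormC m n ⊎ FormD m n

formB-of : ∀ x p q → 2 ≤ x → 1 ≤ q → q < p → FormB (x + (p + q)) (2 ^ x * ((2 ^ p + 1) * (2 ^ q + 1)))
formB-of x p q x≥2 q≥1 q<p =
  x + p , x + q , x , +-monoʳ-< x (m<m+n p q≥1) , +-monoʳ-< x q<p , m<m+n x q≥1 , x≥2 , balance x p q , expand
  where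
  balance : ∀ x p q → x + (p + q) + x ≡ x + p + (x + q)
  balance = solve-∀
  spread : ∀ X P Q → X * ((P + 1) * (Q + 1)) ≡ X * (P * Q) + X * P + X * Q + X
  spread = solve-∀
  expand : 2 ^ x * ((2 ^ p + 1) * (2 ^ q + 1)) ≡ 2 ^ (x + (p + q)) + 2 ^ (x + p) + 2 ^ (x + q) + 2 ^ x
  expand = trans (spread (2 ^ x) (2 ^ p) (2 ^ q))
    (sym (cong₂ _+_ (cong₂ _+_ (cong₂ _+_ (2^-distrib₃ x p q) (^-distribˡ-+-* 2 x p)) (^-distribˡ-+-* 2 x q)) refl))

formB-square : ∀ x p → 2 ≤ x → 2 ≤ p → FormA (x + (p + p)) (2 ^ x * ((2 ^ p + 1) * (2 ^ p + 1)))
formB-square x p x≥2 p≥2 =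
  x + suc p , x , +-monoʳ-< x suc-p<p+p , m<m+n x z<s , m<n⇒0<n x≥2 , expand
  where
  suc-p<p+p : suc p < p + p
  suc-p<p+p = ≤-trans (≤-reflexive (+-comm 2 p)) (+-monoʳ-≤ p p≥2)
  spread : ∀ X P → X * ((P + 1) * (P + 1)) ≡ X * (P * P) + X * (2 * P) + X
  spread = solve-∀
  expand : 2 ^ x * ((2 ^ p + 1) * (2 ^ p + 1)) ≡ 2 ^ (x + (p + p)) + 2 ^ (x + suc p) + 2 ^ x
  expand = trans (spread (2 ^ x) (2 ^ p))
    (sym (cong₂ _+_ (cong₂ _+_ (2^-distrib₃ x p p) (^-distribˡ-+-* 2 x (suc p))) refl))

3≤p+p⇒2≤p : ∀ {p} → 3 ≤ p + p → 2 ≤ p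
3≤p+p⇒2≤p {suc zero} (s≤s (s≤s ()))
3≤p+p⇒2≤p {suc (suc p)} _ = s≤s (s≤s z≤n)

formC-of : ∀ x u → 2 ≤ x → 1 ≤ u → FormC (x + (u + 3)) (2 ^ x * (9 * 2 ^ u + 3))
formC-of x u x≥2 u≥1 =
  suc x , ≤-trans (≤-reflexive (sym (+-suc x 3))) (+-monoʳ-≤ x (+-monoˡ-≤ 3 u≥1)) , +-monoˡ-≤ 3 (s≤s x≥2) , expand
  where
  spread : ∀ X U → X * (9 * U + 3) ≡ X * (U * 8) + X * U + 2 * X + X
  spread = solve-∀
  2^[x+[u+3]∸3] : 2 ^ (x + (u + 3) ∸ 3) ≡ 2 ^ x * 2 ^ u
  2^[x+[u+3]∸3] = trans (cong (2 ^_) (trans (+-∸-assoc x (m≤n+m 3 u)) (cong (x +_) (m+n∸n≡m u 3))))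
                        (^-distribˡ-+-* 2 x u)
  expand : 2 ^ x * (9 * 2 ^ u + 3) ≡ 2 ^ (x + (u + 3)) + 2 ^ (x + (u + 3) ∸ 3) + 2 ^ suc x + 2 ^ x
  expand = trans (spread (2 ^ x) (2 ^ u))
    (sym (cong₂ _+_ (cong₂ _+_ (cong₂ _+_ (2^-distrib₃ x u 3) 2^[x+[u+3]∸3]) refl) refl))

formD-of : ∀ x → 3 ≤ x → FormD (x + 7) (2 ^ x * 135)
formD-of x x≥3 = +-monoˡ-≤ 7 x≥3 , expand
  where
  spread : ∀ X → X * 135 ≡ X * 128 + X * 4 + X * 2 + X * 1
  spread = solve-∀
  shifted : ∀ j → j ≤ 7 → 2 ^ (x + 7 ∸ j) ≡ 2 ^ x * 2 ^ (7 ∸ j)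
  shifted j j≤7 = trans (cong (2 ^_) (+-∸-assoc x j≤7)) (^-distribˡ-+-* 2 x (7 ∸ j))
  expand : 2 ^ x * 135 ≡ 2 ^ (x + 7) + 2 ^ (x + 7 ∸ 5) + 2 ^ (x + 7 ∸ 6) + 2 ^ (x + 7 ∸ 7)
  expand = trans (spread (2 ^ x))
    (sym (cong₂ _+_ (cong₂ _+_ (cong₂ _+_ (shifted 0 z≤n) (shifted 5 ≤-computed)) (shifted 6 ≤-computed)) (shifted 7 ≤-refl)))

exceptional-form : ∀ {n k} (e : Exceptional n k) → Form (Excess.log (exceptional-excess e)) n
exceptional-form (formA x p q x≥1 q≥1 q<p refl _) =
  inj₁ (x + q , x , +-monoʳ-< x q<p , m<m+n x q≥1 , x≥1 , expand)
  where
  spread : ∀ X P Q → X * (P + Q + 1) ≡ X * P + X * Q + X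
  spread = solve-∀
  expand : 2 ^ x * (2 ^ p + 2 ^ q + 1) ≡ 2 ^ (x + p) + 2 ^ (x + q) + 2 ^ x
  expand = trans (spread (2 ^ x) (2 ^ p) (2 ^ q))
                 (cong₂ (λ a b → a + b + 2 ^ x) (sym (^-distribˡ-+-* 2 x p)) (sym (^-distribˡ-+-* 2 x q)))
exceptional-form (formB x p q x≥2 p≥1 q≥1 p+q≥3 refl _) with <-cmp p q
... | tri< p<q _ _ = inj₂ (inj₁ (subst₂ FormB (cong (x +_) (+-comm q p)) (cong (2 ^ x *_) (*-comm (2 ^ q + 1) (2 ^ p + 1)))
                                         (formB-of x q p x≥2 p≥1 p<q)))
... | tri≈ _ refl _ = inj₁ (formB-square x p x≥2 (3≤p+p⇒2≤p p+q≥3))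
... | tri> _ _ q<p = inj₂ (inj₁ (formB-of x p q x≥2 q≥1 q<p))
exceptional-form (formC x u x≥2 u≥1 refl _) = inj₂ (inj₂ (inj₁ (formC-of x u x≥2 u≥1)))
exceptional-form (formD x x≥3 refl _) = inj₂ (inj₂ (inj₂ (formD-of x x≥3)))

log-unique : ∀ {n m t} → 2 ^ m < n → n ≤ 2 ^ suc m → 2 ^ t < n → n ≤ 2 ^ suc t → m ≡ t
log-unique {m = m} {t} 2^m<n n≤2^suc-m 2^t<n n≤2^suc-t with <-cmp m t
... | tri< m<t _ _ = ⊥-elim (<-irrefl refl (<-≤-trans 2^t<n (≤-trans n≤2^suc-m (^-monoʳ-≤ 2 m<t))))
... | tri≈ _ m≡t _ = m≡t
... | tri> _ _ t<m = ⊥-elim (<-irrefl refl (<-≤-trans 2^m<n (≤-trans n≤2^suc-t (^-monoʳ-≤ 2 t<m))))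

exceptional⇒form : ∀ {n m k} → 2 ^ m < n → n ≤ 2 ^ (m + 1) → Exceptional n k → Form m n
exceptional⇒form {n} {m} 2^m<n n≤2^[m+1] e = subst (λ m → Form m n) (sym m≡log) (exceptional-form e)
  where
  open Excess (exceptional-excess e)
  m≡log : m ≡ log
  m≡log = log-unique 2^m<n (subst (λ j → n ≤ 2 ^ j) (+-comm m 1) n≤2^[m+1]) lower (≤-trans (m≤m+n n 2) upper)

shape-bound : ∀ {n m k} → 2 ^ m < n → n ≤ 2 ^ (m + 1) → ¬ SumOfTwoPowers n → ¬ Form m n →
              Shape n k → 4 * n ≤ 2 ^ k
shape-bound _ _ _ _ (power zero () _ _)
shape-bound _ _ ¬two _ (power (suc x) _ eq _) = ⊥-elim (¬two (x , x , trans eq (sym (2^-double x))))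
shape-bound _ _ ¬two _ (twoPowers x p _ _ eq _) = ⊥-elim (¬two (x + p , x , trans eq (sym (2^[m+n]+2^m x p))))
shape-bound 2^m<n n≤ _ ¬form (exceptional e) = ⊥-elim (¬form (exceptional⇒form 2^m<n n≤ e))
shape-bound _ _ _ _ (generic 4n≤2^k) = 4n≤2^k

lastBit : ℕ → ℕ
lastBit 0 = 0
lastBit 1 = 1
lastBit (suc (suc n)) = lastBit n

-- Binary digit sum with explicit fuel; fuel n is enough for n (digitSum-fuel).
digitSum : ℕ → ℕ → ℕ
digitSum zero _ = 0
digitSum (suc fuel) n = lastBit n + digitSum fuel ⌊ n /2⌋

popcount : ℕ → ℕ
popcount n = digitSum n n

digitSum-0 : ∀ f → digitSum f 0 ≡ 0
digitSum-0 zero = refl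
digitSum-0 (suc f) = digitSum-0 f

digitSum-fuel : ∀ {f g} n → n ≤ f → n ≤ g → digitSum f n ≡ digitSum g n
digitSum-fuel {f} {g} zero _ _ = trans (digitSum-0 f) (sym (digitSum-0 g))
digitSum-fuel {suc f} {suc g} (suc n) (s≤s n≤f) (s≤s n≤g) =
  cong (lastBit (suc n) +_) (digitSum-fuel ⌊ suc n /2⌋ (≤-trans half≤n n≤f) (≤-trans half≤n n≤g))
  where
  half≤n : ⌊ suc n /2⌋ ≤ n
  half≤n = s≤s⁻¹ (⌊n/2⌋<n n)

popcount-unfold : ∀ n → popcount (suc n) ≡ lastBit (suc n) + popcount ⌊ suc n /2⌋
popcount-unfold n = cong (lastBit (suc n) +_) (digitSum-fuel ⌊ suc n /2⌋ (s≤s⁻¹ (⌊n/2⌋<n n)) ≤-refl)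

lastBit-double : ∀ t → lastBit (t + t) ≡ 0
lastBit-double zero = refl
lastBit-double (suc t) rewrite +-suc t t = lastBit-double t

lastBit-double+1 : ∀ t → lastBit (suc (t + t)) ≡ 1
lastBit-double+1 zero = refl
lastBit-double+1 (suc t) rewrite +-suc t t = lastBit-double+1 t

⌊double+1/2⌋ : ∀ t → ⌊ suc (t + t) /2⌋ ≡ t
⌊double+1/2⌋ zero = refl
⌊double+1/2⌋ (suc t) rewrite +-suc t t = cong suc (⌊double+1/2⌋ t)

popcount-double : ∀ t → popcount (t + t) ≡ popcount t
popcount-double zero = refl
popcount-double (suc t) = trans (popcount-unfold (t + suc t))
  (cong₂ _+_ (lastBit-double (suc t)) (cong popcount (sym (n≡⌊n+n/2⌋ (suc t)))))

popcount-double+1 : ∀ t → popcount (suc (t + t)) ≡ suc (popcount t)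
popcount-double+1 t = trans (popcount-unfold (t + t))
  (cong₂ _+_ (lastBit-double+1 t) (cong popcount (⌊double+1/2⌋ t)))

data Halves : ℕ → Set where
  even : ∀ t → Halves (t + t)
  odd  : ∀ t → Halves (suc (t + t))

halves : ∀ n → Halves n
halves zero = even 0
halves (suc n) with halves n
... | even t = odd t
... | odd t = subst Halves (cong suc (+-suc t t)) (even (suc t))

popcount-suc : ∀ n → popcount (suc n) ≤ suc (popcount n)
popcount-suc n = go n (<-wellFounded n)
  where
  open ≤-Reasoning
  go : ∀ n → Acc _<_ n → popcount (suc n) ≤ suc (popcount n)
  go n (acc rec) with halves n
  ... | even t = ≤-reflexive (trans (popcount-double+1 t) (cong suc (sym (popcount-double t))))
  ... | odd t = begin
    popcount (suc (suc (t + t)))  ≡⟨ cong (λ m → popcount (suc m)) (+-suc t t) ⟨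
    popcount (suc t + suc t)      ≡⟨ popcount-double (suc t) ⟩
    popcount (suc t)              ≤⟨ go t (rec (s≤s (m≤m+n t t))) ⟩
    suc (popcount t)              ≡⟨ popcount-double+1 t ⟨
    popcount (suc (t + t))        ≤⟨ n≤1+n _ ⟩
    suc (popcount (suc (t + t)))  ∎

popcount-+2^ : ∀ n e → popcount (n + 2 ^ e) ≤ suc (popcount n)
popcount-+2^ n zero = subst (λ m → popcount m ≤ suc (popcount n)) (+-comm 1 n) (popcount-suc n)
popcount-+2^ n (suc e) with halves n
... | even t = begin
  popcount (t + t + 2 ^ suc e)          ≡⟨ cong popcount (regroup t (2 ^ e)) ⟩
  popcount ((t + 2 ^ e) + (t + 2 ^ e))  ≡⟨ popcount-double (t + 2 ^ e) ⟩
  popcount (t + 2 ^ e)                  ≤⟨ popcount-+2^ t e ⟩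
  suc (popcount t)                      ≡⟨ cong suc (popcount-double t) ⟨
  suc (popcount (t + t))                ∎
  where
  open ≤-Reasoning
  regroup : ∀ t E → t + t + 2 * E ≡ (t + E) + (t + E)
  regroup = solve-∀
... | odd t = begin
  popcount (suc (t + t) + 2 ^ suc e)         ≡⟨ cong popcount (regroup t (2 ^ e)) ⟩
  popcount (suc ((t + 2 ^ e) + (t + 2 ^ e))) ≡⟨ popcount-double+1 (t + 2 ^ e) ⟩
  suc (popcount (t + 2 ^ e))                 ≤⟨ s≤s (popcount-+2^ t e) ⟩
  suc (suc (popcount t))                     ≡⟨ cong suc (popcount-double+1 t) ⟨
  suc (popcount (suc (t + t)))               ∎
  where
  open ≤-Reasoning
  regroup : ∀ t E → suc (t + t) + 2 * E ≡ suc ((t + E) + (t + E))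
  regroup = solve-∀

popcount-2^ : ∀ a → popcount (2 ^ a) ≤ 1
popcount-2^ = popcount-+2^ 0

popcount-2^+2^ : ∀ a b → popcount (2 ^ a + 2 ^ b) ≤ 2
popcount-2^+2^ a b = ≤-trans (popcount-+2^ (2 ^ a) b) (s≤s (popcount-2^ a))

popcount-2^+2^+2^ : ∀ a b c → popcount (2 ^ a + 2 ^ b + 2 ^ c) ≤ 3
popcount-2^+2^+2^ a b c = ≤-trans (popcount-+2^ (2 ^ a + 2 ^ b) c) (s≤s (popcount-2^+2^ a b))

popcount-2^+2^+2^+2^ : ∀ a b c d → popcount (2 ^ a + 2 ^ b + 2 ^ c + 2 ^ d) ≤ 4
popcount-2^+2^+2^+2^ a b c d = ≤-trans (popcount-+2^ (2 ^ a + 2 ^ b + 2 ^ c) d) (s≤s (popcount-2^+2^+2^ a b c))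

form-popcount : ∀ {m n} → Form m n → popcount n ≤ 4
form-popcount {m} (inj₁ (m₂ , m₃ , _ , _ , _ , refl)) = m≤n⇒m≤1+n (popcount-2^+2^+2^ m m₂ m₃)
form-popcount {m} (inj₂ (inj₁ (m₂ , m₃ , m₄ , _ , _ , _ , _ , _ , refl))) = popcount-2^+2^+2^+2^ m m₂ m₃ m₄
form-popcount {m} (inj₂ (inj₂ (inj₁ (m₂ , _ , _ , refl)))) = popcount-2^+2^+2^+2^ m (m ∸ 3) m₂ (m₂ ∸ 1)
form-popcount {m} (inj₂ (inj₂ (inj₂ (_ , refl)))) = popcount-2^+2^+2^+2^ m (m ∸ 5) (m ∸ 6) (m ∸ 7)

powerSum : List ℕ → ℕ
powerSum es = sum (map (2 ^_) es)

halve : List ℕ → List ℕ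
halve [] = []
halve (zero ∷ es) = halve es
halve (suc e ∷ es) = e ∷ halve es

zeros : List ℕ → ℕ
zeros [] = 0
zeros (zero ∷ es) = suc (zeros es)
zeros (suc _ ∷ es) = zeros es

powerSum-halve : ∀ es → powerSum es ≡ zeros es + 2 * powerSum (halve es)
powerSum-halve [] = refl
powerSum-halve (zero ∷ es) = cong suc (powerSum-halve es)
powerSum-halve (suc e ∷ es) =
  trans (cong (2 * 2 ^ e +_) (powerSum-halve es)) (regroup (2 ^ e) (zeros es) (powerSum (halve es)))
  where
  regroup : ∀ E z S → 2 * E + (z + 2 * S) ≡ z + 2 * (E + S)
  regroup = solve-∀

length-halve : ∀ es → length es ≡ zeros es + length (halve es)
length-halve [] = refl
length-halve (zero ∷ es) = cong suc (length-halve es)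
length-halve (suc e ∷ es) = trans (cong suc (length-halve es)) (sym (+-suc (zeros es) _))

zeros-∉ : ∀ {es} → All (0 ≢_) es → zeros es ≡ 0
zeros-∉ [] = refl
zeros-∉ {zero ∷ _} (0≢0 ∷ _) = ⊥-elim (0≢0 refl)
zeros-∉ {suc _ ∷ _} (_ ∷ 0∉es) = zeros-∉ 0∉es

zeros≤1 : ∀ {es} → Unique es → zeros es ≤ 1
zeros≤1 [] = z≤n
zeros≤1 {zero ∷ _} (0∉es ∷ _) = s≤s (≤-reflexive (zeros-∉ 0∉es))
zeros≤1 {suc _ ∷ _} (_ ∷ u) = zeros≤1 u

halve-∉ : ∀ {e es} → All (suc e ≢_) es → All (e ≢_) (halve es)
halve-∉ [] = []
halve-∉ {es = zero ∷ _} (_ ∷ e∉es) = halve-∉ e∉es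
halve-∉ {es = suc _ ∷ _} (e≢ ∷ e∉es) = (λ eq → e≢ (cong suc eq)) ∷ halve-∉ e∉es

halve-unique : ∀ {es} → Unique es → Unique (halve es)
halve-unique [] = []
halve-unique {zero ∷ _} (_ ∷ u) = halve-unique u
halve-unique {suc _ ∷ _} (e∉es ∷ u) = halve-∉ e∉es ∷ halve-unique u

popcount-bit+double : ∀ z m → z ≤ 1 → popcount (z + 2 * m) ≡ z + popcount m
popcount-bit+double 0 m _ = trans (cong (λ j → popcount (m + j)) (+-identityʳ m)) (popcount-double m)
popcount-bit+double 1 m _ = trans (cong (λ j → popcount (suc (m + j))) (+-identityʳ m)) (popcount-double+1 m)
popcount-bit+double (suc (suc _)) _ (s≤s ())

length≤popcount : ∀ f es → powerSum es ≤ f → Unique es → length es ≤ popcount (powerSum es)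
length≤popcount zero [] _ _ = z≤n
length≤popcount zero (e ∷ es) sum≤0 _ = ⊥-elim (n≮0 (≤-trans (≤-trans (m^n>0 2 e) (m≤m+n _ _)) sum≤0))
length≤popcount (suc f) es sum≤ u = begin
  length es                    ≡⟨ length-halve es ⟩
  zeros es + length (halve es) ≤⟨ +-monoʳ-≤ (zeros es) (length≤popcount f (halve es) m≤f (halve-unique u)) ⟩
  zeros es + popcount m        ≡⟨ popcount-bit+double (zeros es) m (zeros≤1 u) ⟨
  popcount (zeros es + 2 * m)  ≡⟨ cong popcount (powerSum-halve es) ⟨
  popcount (powerSum es)       ∎
  where
  open ≤-Reasoning
  m : ℕ
  m = powerSum (halve es)
  m≤f : m ≤ f
  m≤f = begin
    m               ≡⟨ n≡⌊n+n/2⌋ m ⟩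
    ⌊ m + m /2⌋     ≤⟨ ⌊n/2⌋-mono (begin
                         m + m                 ≡⟨ cong (m +_) (+-identityʳ m) ⟨
                         2 * m                 ≤⟨ m≤n+m (2 * m) (zeros es) ⟩
                         zeros es + 2 * m      ≡⟨ powerSum-halve es ⟨
                         powerSum es           ≤⟨ sum≤ ⟩
                         suc f                 ∎) ⟩
    ⌊ suc f /2⌋     ≤⟨ s≤s⁻¹ (⌊n/2⌋<n f) ⟩
    f               ∎

5≤popcount : ∀ {n} → SumOfAtLeastFiveDistinctPowers n → 5 ≤ popcount n
5≤popcount (es , u , 5≤length , refl) = ≤-trans 5≤length (length≤popcount _ es ≤-refl u)

shape-bound-popcount : ∀ {n k} → 5 ≤ popcount n → Shape n k → 4 * n ≤ 2 ^ k
shape-bound-popcount 5≤ (power x _ refl _) = ⊥-elim (≤⇒≯ (≤-trans (popcount-2^ x) ≤-computed) 5≤)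
shape-bound-popcount 5≤ (twoPowers x p _ _ refl _) = ⊥-elim (≤⇒≯ (≤-trans two-bits ≤-computed) 5≤)
  where
  two-bits : popcount (2 ^ x * (2 ^ p + 1)) ≤ 2
  two-bits = subst (λ m → popcount m ≤ 2) (2^[m+n]+2^m x p) (popcount-2^+2^ (x + p) x)
shape-bound-popcount 5≤ (exceptional e) = ⊥-elim (≤⇒≯ (form-popcount (exceptional-form e)) 5≤)
shape-bound-popcount _ (generic 4n≤2^k) = 4n≤2^k

complexity-shape : ∀ {n k} → Complexity₂ n k → Shape n k
complexity-shape c with Complexity₂.witness c
... | e , refl , refl = shape e

corollary3p6 : (∀ (n m k : ℕ) → 2 ∣ n → 0 < n → 2 ^ m < n → n ≤ 2 ^ (m + 1) →
    ¬ SumOfTwoPowers n → ¬ FormA m n → ¬ FormB m n → ¬ FormC m n → ¬ FormD m n →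
    Complexity₂ n k → 4 * n ≤ 2 ^ k)
    × (∀ (n k : ℕ) → 2 ∣ n → 0 < n → SumOfAtLeastFiveDistinctPowers n →
    Complexity₂ n k → 4 * n ≤ 2 ^ k)
corollary3p6 =
    -- 2 ∣ n and 0 < n are not used: values of expressions are even and positive anyway.
    (λ n m k _ _ 2^m<n n≤2^[m+1] ¬two ¬A ¬B ¬C ¬D c →
       shape-bound 2^m<n n≤2^[m+1] ¬two [ ¬A , [ ¬B , [ ¬C , ¬D ] ] ] (complexity-shape c))
  , (λ n k _ _ five c → shape-bound-popcount (5≤popcount five) (complexity-shape c))
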